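{- Let $p\ge 2$. For $m\in\{0,1,\ldots,p-1\}$ and $n\in\mathbb N$, \[ H^{(m)}_n := \det_{0 \leq i,j \leq n} F_{q_{i+m} + j}^{(r_{i+m})} = \prod_{i=0}^n \prod_{j=1}^{ip+m} V_j , \] where for $k\in\mathbb N$, $q_k=\lfloor k/(p-1)\rfloor$ and $r_k=k-(p-1)q_k$.
   Context: A $p$-constellation ($p\ge2$) is a planar map (connected graph embedded in the sphere, up to orientation-preserving homeomorphism) whose faces are colored black or white so that adjacent faces have opposite colors, black faces have degree $p$ and white faces have degree a multiple of $p$; edges are oriented with the white face on their right. Rooted means an edge is distinguished, pointed means a vertex is distinguished. In a pointed constellation a vertex is of type $j$ if $j$ is the minimal length of an oriented path from it to the pointed vertex; an edge is of type $j\to j'$ if its origin and endpoint have types $j,j'$. A constellation has weight $\prod_k x_k^{n_k}$, $n_k$ = number of white faces of degree $kp$. For $i\ge1$, $V_i$ is $1$ plus the generating function of pointed rooted $p$-constellations whose root edge is of type $j\to j-1$ with $j\le i$. A $p$-path is a lattice path in $\mathbb Z\times\mathbb N$ with steps rises $(1,p-1)$ and falls $(1,-1)$; its weight is the product over its falls of $V_i$, where $i$ is the starting height of the fall. For $n,r\ge 0$, $F^{(r)}_n$ is the sum of the weights of all $p$-paths from $(-r,r)$ to $(np,0)$. -}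

module Defs where

open import Level using (Level)
open import Algebra.Bundles using (CommutativeRing)
open import Data.Nat using (ℕ; zero; suc; _+_; _*_; _∸_; _/_)
open import Data.Nat.DivMod using ()
open import Data.Fin using (Fin; zero; suc; punchIn)
open import Data.List using (List; []; _∷_; map; _++_)
open import Data.Maybe using (Maybe; just; nothing)

-- Steps of a p-path: a rise (1, p-1) or a fall (1, -1).
data Step : Set where
  rise fall : Step

-- All step sequences of a given length (each such sequence, together with a
-- starting point, determines a lattice path in ℤ × ℤ).
allSeqs : ℕ → List (List Step)
allSeqs zero = [] ∷ []
allSeqs (suc l) = map (rise ∷_) (allSeqs l) ++ map (fall ∷_) (allSeqs l)

endHeight : (p : ℕ) → ℕ → List Step → Maybe ℕ
endHeight p h [] = just h
endHeight p h (rise ∷ s) = endHeight p (h + (p ∸ 1)) s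
endHeight p zero (fall ∷ s) = nothing
endHeight p (suc h) (fall ∷ s) = endHeight p h s

-- q_k = ⌊ k / (p-1) ⌋ and r_k = k - (p-1) q_k  (meaningful for p ≥ 2,
-- where p - 1 = suc (p ∸ 2)).
qq : (p k : ℕ) → ℕ
qq p k = k / suc (p ∸ 2)

rr : (p k : ℕ) → ℕ
rr p k = k ∸ (p ∸ 1) * qq p k

module _ {c ℓ : Level} (R : CommutativeRing c ℓ) where
  open CommutativeRing R using (Carrier; 0#; 1#; -_) renaming (_+_ to _+R_; _*_ to _*R_)

  sumFin : (n : ℕ) → (Fin n → Carrier) → Carrier
  sumFin zero f = 0#
  sumFin (suc n) f = f zero +R sumFin n (λ i → f (suc i))

  sumList : List Carrier → Carrier
  sumList [] = 0#
  sumList (x ∷ xs) = x +R sumList xs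

  prodFrom : ℕ → ℕ → (ℕ → Carrier) → Carrier
  prodFrom a zero f = 1#
  prodFrom a (suc len) f = f a *R prodFrom (suc a) len f

  prod1to : ℕ → (ℕ → Carrier) → Carrier
  prod1to N f = prodFrom 1 N f

  prod0to : ℕ → (ℕ → Carrier) → Carrier
  prod0to n f = prodFrom 0 (suc n) f

  altSign : ℕ → Carrier
  altSign zero = 1#
  altSign (suc j) = - altSign j

  det : (n : ℕ) → (Fin n → Fin n → Carrier) → Carrier
  det zero M = 1#
  det (suc n) M =
    sumFin (suc n) (λ j → altSign (Data.Fin.toℕ j) *R (M zero j *R
      det n (λ i k → M (suc i) (punchIn j k))))

  pathWeight : (p : ℕ) → (V : ℕ → Carrier) → ℕ → List Step → Carrier
  pathWeight p V h [] = 1#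
  pathWeight p V h (rise ∷ s) = pathWeight p V (h + (p ∸ 1)) s
  pathWeight p V zero (fall ∷ s) = 0#
  pathWeight p V (suc h) (fall ∷ s) = V (suc h) *R pathWeight p V h s

  contrib : (p : ℕ) → (V : ℕ → Carrier) → ℕ → List Step → Carrier
  contrib p V r s with endHeight p r s
  ... | just zero = pathWeight p V r s
  ... | just (suc _) = 0#
  ... | nothing = 0#

  -- F^{(r)}_n : sum of weights of all p-paths from (-r, r) to (n p, 0);
  -- such paths have exactly r + n p steps.
  F : (p : ℕ) → (V : ℕ → Carrier) → (r n : ℕ) → Carrier
  F p V r n = sumList (map (contrib p V r) (allSeqs (r + n * p)))

module Submission where

-- Idea: the matrix factorises as L · U.  Cut every path counted by
-- F^{(r_i)}_{q_i+j} (writing q_i, r_i for q_{i+m}, r_{i+m}) after its first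
-- i + q_i steps.  Since r_i + (p-1) q_i = i + m, the height reached there is a
-- level t p + m with t ≤ i, and level i is reached only by the all-rises path.
-- So L i t, the weighted count of these first parts ending at level t, is
-- lower unitriangular; U t j, the weighted count of paths from level t to
-- height 0 with j p + m steps, is upper triangular (such paths have j - t
-- rises) with U t t = V_1 ⋯ V_{tp+m} (only the all-falls path).  Hence the
-- determinant is ∏_t U t t.

open import Level using (Level)
open import Algebra.Bundles using (CommutativeRing)
open import Data.Nat using (ℕ; zero; suc; _+_; _*_; _∸_; _≤_; _<_; z≤n; s≤s; _≟_; _<?_)
import Data.Nat.Properties as ℕ
open import Data.Nat.DivMod using (m/n*n≤m)
open import Data.Nat.Tactic.RingSolver using (solve-∀)
open import Data.Fin using (Fin; toℕ; punchIn) renaming (zero to fzero; suc to fsuc)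
open import Data.List using (List; []; _∷_; _++_; length; replicate; map)
import Data.List.Properties as List
open import Data.Maybe using (Maybe; just; nothing; _>>=_)
import Data.Maybe.Properties as Maybe
open import Data.Product using (Σ-syntax; _×_; _,_)
open import Data.Empty using (⊥-elim)
open import Relation.Nullary using (¬_; Dec; yes; no)
open import Relation.Binary.PropositionalEquality as ≡ using (_≡_; _≢_; cong)
open import Function using (_∘_)
open import Defs

-- Column k of the j-th minor is column `punchInℕ j k` of the matrix: the
-- ℕ-version of `Data.Fin.punchIn`, with `punchOutℕ` its partial inverse.
punchInℕ : ℕ → ℕ → ℕ
punchInℕ zero    k       = suc k
punchInℕ (suc j) zero    = zero
punchInℕ (suc j) (suc k) = suc (punchInℕ j k)

punchOutℕ : ℕ → ℕ → ℕ
punchOutℕ zero    zero    = zero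
punchOutℕ zero    (suc c) = c
punchOutℕ (suc j) zero    = zero
punchOutℕ (suc j) (suc c) = suc (punchOutℕ j c)

toℕ-punchIn : ∀ {n} (j : Fin (suc n)) (k : Fin n) → toℕ (punchIn j k) ≡ punchInℕ (toℕ j) (toℕ k)
toℕ-punchIn fzero    k        = ≡.refl
toℕ-punchIn (fsuc j) fzero    = ≡.refl
toℕ-punchIn (fsuc j) (fsuc k) = cong suc (toℕ-punchIn j k)

punchInℕ-≢ : ∀ j k → punchInℕ j k ≢ j
punchInℕ-≢ (suc j) (suc k) = punchInℕ-≢ j k ∘ ℕ.suc-injective

punchInℕ-injective : ∀ j a b → punchInℕ j a ≡ punchInℕ j b → a ≡ b
punchInℕ-injective zero    a       b       e = ℕ.suc-injective e
punchInℕ-injective (suc j) zero    zero    e = ≡.refl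
punchInℕ-injective (suc j) (suc a) (suc b) e = cong suc (punchInℕ-injective j a b (ℕ.suc-injective e))

punchInℕ-< : ∀ j {k n} → k < n → punchInℕ j k < suc n
punchInℕ-< zero    k<n               = s≤s k<n
punchInℕ-< (suc j) {zero}  k<n       = s≤s z≤n
punchInℕ-< (suc j) {suc k} (s≤s k<n) = s≤s (punchInℕ-< j k<n)

punchInℕ-punchOutℕ : ∀ j c → c ≢ j → punchInℕ j (punchOutℕ j c) ≡ c
punchInℕ-punchOutℕ zero    zero    c≢j = ⊥-elim (c≢j ≡.refl)
punchInℕ-punchOutℕ zero    (suc c) c≢j = ≡.refl
punchInℕ-punchOutℕ (suc j) zero    c≢j = ≡.refl
punchInℕ-punchOutℕ (suc j) (suc c) c≢j = cong suc (punchInℕ-punchOutℕ j c (c≢j ∘ cong suc))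

punchOutℕ-< : ∀ {n} j c → j < suc n → c < suc n → c ≢ j → punchOutℕ j c < n
punchOutℕ-<         zero    zero    _         _         c≢j = ⊥-elim (c≢j ≡.refl)
punchOutℕ-<         zero    (suc c) _         (s≤s c<n) _   = c<n
punchOutℕ-< {suc n} (suc j) zero    _         _         _   = s≤s z≤n
punchOutℕ-< {suc n} (suc j) (suc c) (s≤s j<n) (s≤s c<n) c≢j = s≤s (punchOutℕ-< j c j<n c<n (c≢j ∘ cong suc))
punchOutℕ-< {zero}  (suc j) _       (s≤s ())  _         _

punchOutℕ-suc : ∀ j c → c ≢ j → suc c ≢ j → punchOutℕ j (suc c) ≡ suc (punchOutℕ j c)
punchOutℕ-suc zero          zero    c≢j  _    = ⊥-elim (c≢j ≡.refl)
punchOutℕ-suc zero          (suc c) _    _    = ≡.refl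
punchOutℕ-suc (suc zero)    zero    _    c+1≢j = ⊥-elim (c+1≢j ≡.refl)
punchOutℕ-suc (suc (suc j)) zero    _    _    = ≡.refl
punchOutℕ-suc (suc j)       (suc c) c≢j c+1≢j = cong suc (punchOutℕ-suc j c (c≢j ∘ cong suc) (c+1≢j ∘ cong suc))

-- The minors obtained by deleting column c or column c+1 see the same
-- columns, except that column c of the first is column c of the matrix
-- and column c of the second is column c+1.
punchInℕ-adjacent : ∀ c k → k ≢ c → punchInℕ c k ≡ punchInℕ (suc c) k
punchInℕ-adjacent zero    zero    k≢c = ⊥-elim (k≢c ≡.refl)
punchInℕ-adjacent zero    (suc k) _   = ≡.refl
punchInℕ-adjacent (suc c) zero    _   = ≡.refl
punchInℕ-adjacent (suc c) (suc k) k≢c = cong suc (punchInℕ-adjacent c k (k≢c ∘ cong suc))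

punchInℕ-self : ∀ c → punchInℕ c c ≡ suc c
punchInℕ-self zero    = ≡.refl
punchInℕ-self (suc c) = cong suc (punchInℕ-self c)

punchInℕ-pred : ∀ c → punchInℕ (suc c) c ≡ c
punchInℕ-pred zero    = ≡.refl
punchInℕ-pred (suc c) = cong suc (punchInℕ-pred c)

quotient-shift : ∀ p q a h m → m < p → h + q * p ≡ a * p + m → Σ[ t ∈ ℕ ] a ≡ q + t × h ≡ t * p + m
quotient-shift p zero    a       h m m<p e = a , ≡.refl , ≡.trans (≡.sym (ℕ.+-identityʳ h)) e
quotient-shift p (suc q) zero    h m m<p e = ⊥-elim (ℕ.<⇒≱ m<p (≡.subst (p ≤_) e p≤lhs))
  where
  p≤lhs : p ≤ h + (p + q * p)
  p≤lhs = ℕ.≤-trans (ℕ.m≤m+n p (q * p)) (ℕ.m≤n+m (p + q * p) h)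
quotient-shift p (suc q) (suc a) h m m<p e with quotient-shift p q a h m m<p (ℕ.+-cancelˡ-≡ p _ _ shifted)
  where
  open ≡.≡-Reasoning
  regroup : ∀ p h q → p + (h + q * p) ≡ h + suc q * p
  regroup = solve-∀
  shifted : p + (h + q * p) ≡ p + (a * p + m)
  shifted = begin
    p + (h + q * p)   ≡⟨ regroup p h q ⟩
    h + suc q * p     ≡⟨ e ⟩
    suc a * p + m     ≡⟨ ℕ.+-assoc p (a * p) m ⟩
    p + (a * p + m)   ∎
... | t , a≡q+t , h≡ = t , cong suc a≡q+t , h≡

rises : List Step → ℕ
rises []         = 0
rises (rise ∷ s) = suc (rises s)
rises (fall ∷ s) = rises s

rises-≤ : ∀ s → rises s ≤ length s
rises-≤ []         = z≤n
rises-≤ (rise ∷ s) = s≤s (rises-≤ s)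
rises-≤ (fall ∷ s) = ℕ.m≤n⇒m≤1+n (rises-≤ s)

rises≡length : ∀ s → rises s ≡ length s → s ≡ replicate (length s) rise
rises≡length []         e = ≡.refl
rises≡length (rise ∷ s) e = cong (rise ∷_) (rises≡length s (ℕ.suc-injective e))
rises≡length (fall ∷ s) e = ⊥-elim (ℕ.<-irrefl e (s≤s (rises-≤ s)))

rises≡0 : ∀ s → rises s ≡ 0 → s ≡ replicate (length s) fall
rises≡0 []         e = ≡.refl
rises≡0 (fall ∷ s) e = cong (fall ∷_) (rises≡0 s e)

-- Heights of p-paths, p = D + 1: a rise adds D, a fall subtracts 1.
module Heights (D : ℕ) where
  open ≡.≡-Reasoning

  end : ℕ → List Step → Maybe ℕ
  end = endHeight (suc D)

  end-++ : ∀ h s₁ s₂ → end h (s₁ ++ s₂) ≡ (end h s₁ >>= λ x → end x s₂)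
  end-++ h       []          s₂ = ≡.refl
  end-++ h       (rise ∷ s₁) s₂ = end-++ (h + D) s₁ s₂
  end-++ zero    (fall ∷ s₁) s₂ = ≡.refl
  end-++ (suc h) (fall ∷ s₁) s₂ = end-++ h s₁ s₂

  -- Each step moves one unit right, so comparing heights and lengths:
  -- end height + length = start height + p · (number of rises).
  end-length : ∀ h s {h′} → end h s ≡ just h′ → h′ + length s ≡ h + suc D * rises s
  end-length h       []         ≡.refl = cong (h +_) (≡.sym (ℕ.*-zeroʳ (suc D)))
  end-length h       (rise ∷ s) {h′} e = begin
    h′ + suc (length s)          ≡⟨ ℕ.+-suc h′ (length s) ⟩
    suc (h′ + length s)          ≡⟨ cong suc (end-length (h + D) s e) ⟩
    suc (h + D + suc D * rises s) ≡⟨ rearrange h D (rises s) ⟩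
    h + suc D * suc (rises s)    ∎
    where
    rearrange : ∀ h d a → suc (h + d + suc d * a) ≡ h + suc d * suc a
    rearrange = solve-∀
  end-length (suc h) (fall ∷ s) {h′} e = ≡.trans (ℕ.+-suc h′ (length s)) (cong suc (end-length h s e))

  end-rises : ∀ h L → end h (replicate L rise) ≡ just (h + L * D)
  end-rises h zero    = cong just (≡.sym (ℕ.+-identityʳ h))
  end-rises h (suc L) = ≡.trans (end-rises (h + D) L) (cong just (ℕ.+-assoc h D (L * D)))

  end-falls : ∀ h → end h (replicate h fall) ≡ just 0
  end-falls zero    = ≡.refl
  end-falls (suc h) = end-falls h

-- Arithmetic of the rows of the matrix of the theorem, for p = d + 2 and
-- 0 ≤ m < p.  Row i uses F^{(r_i)}_{q_i + j} with i + m = (p-1) q_i + r_i; its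
-- paths are cut after i + q_i steps, where they have reached a level t·p + m.
module Levels (d m : ℕ) (m<p : m < suc (suc d)) where
  D p : ℕ
  D = suc d
  p = suc D
  open Heights D
  open ≡.≡-Reasoning

  level : ℕ → ℕ
  level t = t * p + m

  level-injective : ∀ {t t′} → level t ≡ level t′ → t ≡ t′
  level-injective {t} {t′} e = ℕ.*-cancelʳ-≡ t t′ p (ℕ.+-cancelʳ-≡ m (t * p) (t′ * p) e)

  q r : ℕ → ℕ
  q i = qq p (i + m)
  r i = rr p (i + m)

  r+Dq : ∀ i → r i + D * q i ≡ i + m
  r+Dq i = ℕ.m∸n+n≡m (≡.subst (_≤ i + m) (ℕ.*-comm (q i) D) (m/n*n≤m (i + m) D))

  end-level : ∀ i s {h′} → length s ≡ i + q i → end (r i) s ≡ just h′ →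
              Σ[ t ∈ ℕ ] t ≤ i × rises s ≡ q i + t × h′ ≡ level t
  end-level i s {h′} len e with quotient-shift p (q i) (rises s) h′ m m<p divided
    where
    regroup₁ : ∀ i h q d → i + (h + q * suc (suc d)) ≡ h + (i + q) + suc d * q
    regroup₁ = solve-∀
    regroup₂ : ∀ r d a q → r + suc (suc d) * a + suc d * q ≡ r + suc d * q + a * suc (suc d)
    regroup₂ = solve-∀
    regroup₃ : ∀ i m x → i + m + x ≡ i + (x + m)
    regroup₃ = solve-∀
    divided : h′ + q i * p ≡ rises s * p + m
    divided = ℕ.+-cancelˡ-≡ i _ _ (begin
      i + (h′ + q i * p)            ≡⟨ regroup₁ i h′ (q i) d ⟩
      h′ + (i + q i) + D * q i      ≡⟨ cong (λ x → h′ + x + D * q i) (≡.sym len) ⟩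
      h′ + length s + D * q i       ≡⟨ cong (_+ D * q i) (end-length (r i) s e) ⟩
      r i + p * rises s + D * q i   ≡⟨ regroup₂ (r i) d (rises s) (q i) ⟩
      r i + D * q i + rises s * p   ≡⟨ cong (_+ rises s * p) (r+Dq i) ⟩
      i + m + rises s * p           ≡⟨ regroup₃ i m (rises s * p) ⟩
      i + (rises s * p + m)         ∎)
  ... | t , rises≡q+t , h′≡ = t , t≤i , rises≡q+t , h′≡
    where
    t≤i : t ≤ i
    t≤i = ℕ.+-cancelˡ-≤ (q i) t i
      (≡.subst₂ _≤_ rises≡q+t (≡.trans len (ℕ.+-comm i (q i))) (rises-≤ s))

  -- F^{(r_i)}_{q_i + j} counts paths with (i + q_i) + (j p + m) steps.
  F-length : ∀ i j → r i + (q i + j) * p ≡ (i + q i) + level j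
  F-length i j = begin
    r i + (q i + j) * p          ≡⟨ regroup₁ (r i) (q i) j d ⟩
    r i + D * q i + q i + j * p  ≡⟨ cong (λ x → x + q i + j * p) (r+Dq i) ⟩
    i + m + q i + j * p          ≡⟨ regroup₂ i m (q i) (j * p) ⟩
    (i + q i) + (j * p + m)      ∎
    where
    regroup₁ : ∀ r q j d → r + (q + j) * suc (suc d) ≡ r + suc d * q + q + j * suc (suc d)
    regroup₁ = solve-∀
    regroup₂ : ∀ i m q x → i + m + q + x ≡ (i + q) + (x + m)
    regroup₂ = solve-∀

  -- The all-rises path with i + q_i steps from r_i ends at level i.
  rises-end : ∀ i → r i + (i + q i) * D ≡ level i
  rises-end i = begin
    r i + (i + q i) * D      ≡⟨ regroup₁ (r i) i (q i) D ⟩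
    r i + D * q i + i * D    ≡⟨ cong (_+ i * D) (r+Dq i) ⟩
    i + m + i * D            ≡⟨ regroup₂ i m D ⟩
    level i                  ∎
    where
    regroup₁ : ∀ r i q d → r + (i + q) * d ≡ r + d * q + i * d
    regroup₁ = solve-∀
    regroup₂ : ∀ i m d → i + m + i * d ≡ i * suc d + m
    regroup₂ = solve-∀

  descent : ∀ t j s → length s ≡ level j → end (level t) s ≡ just 0 → j ≡ t + rises s
  descent t j s len e = level-injective (begin
    level j                        ≡⟨ ≡.sym len ⟩
    length s                       ≡⟨ end-length (level t) s e ⟩
    t * p + m + p * rises s        ≡⟨ regroup t m (rises s) d ⟩
    level (t + rises s)            ∎)
    where
    regroup : ∀ t m a d → t * suc (suc d) + m + suc (suc d) * a ≡ (t + a) * suc (suc d) + m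
    regroup = solve-∀

module FiniteSums {c ℓ : Level} (R : CommutativeRing c ℓ) where
  open CommutativeRing R renaming (Carrier to C; _+_ to _⊕_; _*_ to _⊗_)
  open import Relation.Binary.Reasoning.Setoid setoid
  open import Algebra.Properties.CommutativeSemigroup +-commutativeSemigroup using (interchange)

  ≡⇒≈ : ∀ {x y} → x ≡ y → x ≈ y
  ≡⇒≈ ≡.refl = refl

  sumTo : ℕ → (ℕ → C) → C
  sumTo zero    f = 0#
  sumTo (suc n) f = f 0 ⊕ sumTo n (f ∘ suc)

  sumTo-cong : ∀ n {f g} → (∀ j → j < n → f j ≈ g j) → sumTo n f ≈ sumTo n g
  sumTo-cong zero    f≈g = refl
  sumTo-cong (suc n) f≈g = +-cong (f≈g 0 (s≤s z≤n)) (sumTo-cong n (λ j → f≈g (suc j) ∘ s≤s))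

  sumTo-zero : ∀ n {f} → (∀ j → j < n → f j ≈ 0#) → sumTo n f ≈ 0#
  sumTo-zero zero    f≈0 = refl
  sumTo-zero (suc n) f≈0 = trans (+-cong (f≈0 0 (s≤s z≤n)) (sumTo-zero n (λ j → f≈0 (suc j) ∘ s≤s))) (+-identityˡ 0#)

  sumTo-single : ∀ n {f} a → a < n → (∀ j → j < n → j ≢ a → f j ≈ 0#) → sumTo n f ≈ f a
  sumTo-single (suc n) zero _ others =
    trans (+-cong refl (sumTo-zero n (λ j j<n → others (suc j) (s≤s j<n) λ ())))  (+-identityʳ _)
  sumTo-single (suc n) (suc a) (s≤s a<n) others =
    trans (+-cong (others 0 (s≤s z≤n) λ ())
                  (sumTo-single n a a<n (λ j j<n j≢a → others (suc j) (s≤s j<n) (j≢a ∘ ℕ.suc-injective))))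
          (+-identityˡ _)

  sumTo-+ : ∀ n f g → sumTo n (λ j → f j ⊕ g j) ≈ sumTo n f ⊕ sumTo n g
  sumTo-+ zero    f g = sym (+-identityˡ 0#)
  sumTo-+ (suc n) f g = trans (+-cong refl (sumTo-+ n (f ∘ suc) (g ∘ suc))) (interchange _ _ _ _)

  sumTo-scale : ∀ n x f → sumTo n (λ j → x ⊗ f j) ≈ x ⊗ sumTo n f
  sumTo-scale zero    x f = sym (zeroʳ x)
  sumTo-scale (suc n) x f = trans (+-cong refl (sumTo-scale n x (f ∘ suc))) (sym (distribˡ x _ _))

  sumTo-pair : ∀ n {f} a → suc a < n → (∀ j → j < n → j ≢ a → j ≢ suc a → f j ≈ 0#) →
               f a ⊕ f (suc a) ≈ 0# → sumTo n f ≈ 0#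
  sumTo-pair (suc (suc n)) {f} zero _ others pair = begin
    f 0 ⊕ (f 1 ⊕ sumTo n (f ∘ suc ∘ suc)) ≈⟨ sym (+-assoc _ _ _) ⟩
    (f 0 ⊕ f 1) ⊕ sumTo n (f ∘ suc ∘ suc) ≈⟨ +-cong pair (sumTo-zero n λ j j<n →
                                                others (suc (suc j)) (s≤s (s≤s j<n)) (λ ()) (λ ())) ⟩
    0# ⊕ 0#                                ≈⟨ +-identityˡ 0# ⟩
    0#                                     ∎
  sumTo-pair (suc n) (suc a) (s≤s a+1<n) others pair =
    trans (+-cong (others 0 (s≤s z≤n) (λ ()) (λ ()))
                  (sumTo-pair n a a+1<n (λ j j<n j≢a j≢a+1 →
                     others (suc j) (s≤s j<n) (j≢a ∘ ℕ.suc-injective) (j≢a+1 ∘ ℕ.suc-injective)) pair))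
          (+-identityˡ 0#)

  sumOver : ∀ {A : Set} → List A → (A → C) → C
  sumOver xs f = sumList R (map f xs)

  sumOver-++ : ∀ {A : Set} (xs ys : List A) f → sumOver (xs ++ ys) f ≈ sumOver xs f ⊕ sumOver ys f
  sumOver-++ []       ys f = sym (+-identityˡ _)
  sumOver-++ (x ∷ xs) ys f = trans (+-cong refl (sumOver-++ xs ys f)) (sym (+-assoc _ _ _))

  sumOver-scaleˡ : ∀ {A : Set} (xs : List A) y f → sumOver xs (λ x → y ⊗ f x) ≈ y ⊗ sumOver xs f
  sumOver-scaleˡ []       y f = sym (zeroʳ y)
  sumOver-scaleˡ (x ∷ xs) y f = trans (+-cong refl (sumOver-scaleˡ xs y f)) (sym (distribˡ y _ _))

  sumOver-scaleʳ : ∀ {A : Set} (xs : List A) f y → sumOver xs (λ x → f x ⊗ y) ≈ sumOver xs f ⊗ y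
  sumOver-scaleʳ []       f y = sym (zeroˡ y)
  sumOver-scaleʳ (x ∷ xs) f y = trans (+-cong refl (sumOver-scaleʳ xs f y)) (sym (distribʳ y _ _))

  sumOver-sumTo : ∀ {A : Set} (xs : List A) T (g : ℕ → A → C) →
                  sumOver xs (λ x → sumTo T (λ t → g t x)) ≈ sumTo T (λ t → sumOver xs (g t))
  sumOver-sumTo []       T g = sym (sumTo-zero T (λ _ _ → refl))
  sumOver-sumTo (x ∷ xs) T g = trans (+-cong refl (sumOver-sumTo xs T g)) (sym (sumTo-+ T _ _))

  prodFrom-cong : ∀ a L {f g : ℕ → C} → (∀ x → f x ≈ g x) → prodFrom R a L f ≈ prodFrom R a L g
  prodFrom-cong a zero    f≈g = refl
  prodFrom-cong a (suc L) f≈g = *-cong (f≈g a) (prodFrom-cong (suc a) L f≈g)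

  prodFrom-snoc : ∀ a L (f : ℕ → C) → prodFrom R a (suc L) f ≈ prodFrom R a L f ⊗ f (a + L)
  prodFrom-snoc a zero    f = trans (*-comm _ _) (*-cong refl (≡⇒≈ (cong f (≡.sym (ℕ.+-identityʳ a)))))
  prodFrom-snoc a (suc L) f = trans (*-cong refl (prodFrom-snoc (suc a) L f))
    (trans (sym (*-assoc _ _ _)) (*-cong refl (≡⇒≈ (cong f (≡.sym (ℕ.+-suc a L))))))

-- Determinants of ℕ-indexed matrices (only the entries below the size
-- matter), expanded along the first row as in `Defs.det`.
module Determinants {c ℓ : Level} (R : CommutativeRing c ℓ) where
  open CommutativeRing R renaming (Carrier to C; _+_ to _⊕_; _*_ to _⊗_; -_ to ⊖_)
  open import Relation.Binary.Reasoning.Setoid setoid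
  open import Algebra.Solver.Ring.NaturalCoefficients.Default commutativeSemiring using (solve; _:+_; _:*_; _:=_)
  open FiniteSums R

  Matrix : Set c
  Matrix = ℕ → ℕ → C

  minor : Matrix → ℕ → Matrix
  minor M j i k = M (suc i) (punchInℕ j k)

  det′ : ℕ → Matrix → C
  expansionTerm : ℕ → Matrix → ℕ → C

  det′ zero    M = 1#
  det′ (suc n) M = sumTo (suc n) (expansionTerm n M)

  expansionTerm n M j = altSign R j ⊗ (M 0 j ⊗ det′ n (minor M j))

  sumFin≈sumTo : ∀ n (g : Fin n → C) (f : ℕ → C) → (∀ j → g j ≈ f (toℕ j)) → sumFin R n g ≈ sumTo n f
  sumFin≈sumTo zero    g f g≈f = refl
  sumFin≈sumTo (suc n) g f g≈f = +-cong (g≈f fzero) (sumFin≈sumTo n (g ∘ fsuc) (f ∘ suc) (g≈f ∘ fsuc))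

  det≈det′ : ∀ n (M : Fin n → Fin n → C) (N : Matrix) → (∀ i j → M i j ≈ N (toℕ i) (toℕ j)) → det R n M ≈ det′ n N
  det≈det′ zero    M N M≈N = refl
  det≈det′ (suc n) M N M≈N = sumFin≈sumTo (suc n) _ (expansionTerm n N) λ j →
    *-cong refl (*-cong (M≈N fzero j) (det≈det′ n _ (minor N (toℕ j)) λ i k →
      trans (M≈N (fsuc i) (punchIn j k)) (≡⇒≈ (cong (N (suc (toℕ i))) (toℕ-punchIn j k)))))

  det′-cong : ∀ n {M N} → (∀ i k → i < n → k < n → M i k ≈ N i k) → det′ n M ≈ det′ n N
  det′-cong zero    M≈N = refl
  det′-cong (suc n) {M} {N} M≈N = sumTo-cong (suc n) {expansionTerm n M} {expansionTerm n N} λ j j<n →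
    *-cong refl (*-cong (M≈N 0 j (s≤s z≤n) j<n)
      (det′-cong n (λ i k i<n k<n → M≈N (suc i) (punchInℕ j k) (s≤s i<n) (punchInℕ-< j k<n))))

  AgreeOff : Matrix → Matrix → ℕ → Set ℓ
  AgreeOff A B c = ∀ i k → k ≢ c → A i k ≈ B i k

  minor-agreeOff : ∀ {A B c} j → c ≢ j → AgreeOff A B c → AgreeOff (minor A j) (minor B j) (punchOutℕ j c)
  minor-agreeOff {c = c} j c≢j A~B i k k≢c′ = A~B (suc i) (punchInℕ j k) λ e →
    k≢c′ (punchInℕ-injective j k (punchOutℕ j c) (≡.trans e (≡.sym (punchInℕ-punchOutℕ j c c≢j))))

  minor-column : ∀ (A : Matrix) j c i → c ≢ j → minor A j i (punchOutℕ j c) ≡ A (suc i) c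
  minor-column A j c i c≢j = cong (A (suc i)) (punchInℕ-punchOutℕ j c c≢j)

  minor-agreeAt : ∀ {A B c} → AgreeOff A B c → ∀ i k → minor A c i k ≈ minor B c i k
  minor-agreeAt {c = c} A~B i k = A~B (suc i) (punchInℕ c k) (punchInℕ-≢ c k)

  -- The determinant is linear in each column: expanding along the first row,
  -- the term of column c is linear through its entry, the other terms
  -- through their minors (induction).
  det′-linear : ∀ n c x y {A B D} → c < n → AgreeOff A B c → AgreeOff A D c →
                (∀ i → A i c ≈ x ⊗ B i c ⊕ y ⊗ D i c) →
                det′ n A ≈ x ⊗ det′ n B ⊕ y ⊗ det′ n D
  expansionTerm-linear : ∀ n c x y {A B D} → c < suc n → AgreeOff A B c → AgreeOff A D c →
                         (∀ i → A i c ≈ x ⊗ B i c ⊕ y ⊗ D i c) → ∀ j → j < suc n →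
                         expansionTerm n A j ≈ x ⊗ expansionTerm n B j ⊕ y ⊗ expansionTerm n D j

  det′-linear (suc n) c x y {A} {B} {D} c<n A~B A~D column = begin
    sumTo (suc n) (expansionTerm n A)
      ≈⟨ sumTo-cong (suc n) (expansionTerm-linear n c x y c<n A~B A~D column) ⟩
    sumTo (suc n) (λ j → x ⊗ expansionTerm n B j ⊕ y ⊗ expansionTerm n D j)
      ≈⟨ sumTo-+ (suc n) (λ j → x ⊗ expansionTerm n B j) (λ j → y ⊗ expansionTerm n D j) ⟩
    sumTo (suc n) (λ j → x ⊗ expansionTerm n B j) ⊕ sumTo (suc n) (λ j → y ⊗ expansionTerm n D j)
      ≈⟨ +-cong (sumTo-scale (suc n) x (expansionTerm n B)) (sumTo-scale (suc n) y (expansionTerm n D)) ⟩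
    x ⊗ det′ (suc n) B ⊕ y ⊗ det′ (suc n) D ∎

  expansionTerm-linear n c x y {A} {B} {D} c<n A~B A~D column j j<n with j ≟ c
  ... | yes ≡.refl = begin
    s ⊗ (A 0 j ⊗ det′ n (minor A j))
      ≈⟨ *-cong refl (*-cong (column 0) (det′-cong n λ i k _ _ → minor-agreeAt A~B i k)) ⟩
    s ⊗ ((x ⊗ B 0 j ⊕ y ⊗ D 0 j) ⊗ det′ n (minor B j))
      ≈⟨ solve 6 (λ s x y b d X → s :* ((x :* b :+ y :* d) :* X) := x :* (s :* (b :* X)) :+ y :* (s :* (d :* X)))
               refl s x y (B 0 j) (D 0 j) (det′ n (minor B j)) ⟩
    x ⊗ (s ⊗ (B 0 j ⊗ det′ n (minor B j))) ⊕ y ⊗ (s ⊗ (D 0 j ⊗ det′ n (minor B j)))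
      ≈⟨ +-cong refl (*-cong refl (*-cong refl (*-cong refl
           (det′-cong n λ i k _ _ → trans (sym (minor-agreeAt A~B i k)) (minor-agreeAt A~D i k))))) ⟩
    x ⊗ (s ⊗ (B 0 j ⊗ det′ n (minor B j))) ⊕ y ⊗ (s ⊗ (D 0 j ⊗ det′ n (minor D j))) ∎
    where
    s : C
    s = altSign R j
  ... | no j≢c = begin
    s ⊗ (A 0 j ⊗ det′ n (minor A j))
      ≈⟨ *-cong refl (*-cong refl (det′-linear n (punchOutℕ j c) x y (punchOutℕ-< j c j<n c<n c≢j)
           (minor-agreeOff j c≢j A~B) (minor-agreeOff j c≢j A~D)
           (λ i → trans (at A i) (trans (column (suc i)) (sym (+-cong (*-cong refl (at B i)) (*-cong refl (at D i)))))))) ⟩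
    s ⊗ (A 0 j ⊗ (x ⊗ det′ n (minor B j) ⊕ y ⊗ det′ n (minor D j)))
      ≈⟨ solve 6 (λ s x y a X Y → s :* (a :* (x :* X :+ y :* Y)) := x :* (s :* (a :* X)) :+ y :* (s :* (a :* Y)))
               refl s x y (A 0 j) (det′ n (minor B j)) (det′ n (minor D j)) ⟩
    x ⊗ (s ⊗ (A 0 j ⊗ det′ n (minor B j))) ⊕ y ⊗ (s ⊗ (A 0 j ⊗ det′ n (minor D j)))
      ≈⟨ +-cong (*-cong refl (*-cong refl (*-cong (A~B 0 j j≢c) refl))) (*-cong refl (*-cong refl (*-cong (A~D 0 j j≢c) refl))) ⟩
    x ⊗ (s ⊗ (B 0 j ⊗ det′ n (minor B j))) ⊕ y ⊗ (s ⊗ (D 0 j ⊗ det′ n (minor D j))) ∎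
    where
    s : C
    s = altSign R j
    c≢j : c ≢ j
    c≢j = j≢c ∘ ≡.sym
    at : ∀ X i → minor X j i (punchOutℕ j c) ≈ X (suc i) c
    at X i = ≡⇒≈ (minor-column X j c i c≢j)

  replaceCol : Matrix → ℕ → (ℕ → C) → Matrix
  replaceCol M c u i k with k ≟ c
  ... | yes _ = u i
  ... | no  _ = M i k

  replaceCol-at : ∀ M c u i → replaceCol M c u i c ≈ u i
  replaceCol-at M c u i with c ≟ c
  ... | yes _   = refl
  ... | no  c≢c = ⊥-elim (c≢c ≡.refl)

  replaceCol-off : ∀ M c u → AgreeOff (replaceCol M c u) M c
  replaceCol-off M c u i k k≢c with k ≟ c
  ... | yes k≡c = ⊥-elim (k≢c k≡c)
  ... | no  _   = refl

  replaceCol-sameOff : ∀ M c u v → AgreeOff (replaceCol M c u) (replaceCol M c v) c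
  replaceCol-sameOff M c u v i k k≢c = trans (replaceCol-off M c u i k k≢c) (sym (replaceCol-off M c v i k k≢c))

  replaceCol-agreeOff : ∀ {A B c} d u → AgreeOff A B c → AgreeOff (replaceCol A d u) (replaceCol B d u) c
  replaceCol-agreeOff d u A~B i k k≢c with k ≟ d
  ... | yes _ = refl
  ... | no  _ = A~B i k k≢c

  det′-additive : ∀ n c {A B D} → c < n → AgreeOff A B c → AgreeOff A D c →
                  (∀ i → A i c ≈ B i c ⊕ D i c) → det′ n A ≈ det′ n B ⊕ det′ n D
  det′-additive n c c<n A~B A~D column =
    trans (det′-linear n c 1# 1# c<n A~B A~D (λ i → trans (column i) (+-cong (sym (*-identityˡ _)) (sym (*-identityˡ _)))))
          (+-cong (*-identityˡ _) (*-identityˡ _))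

  det′-scale : ∀ n c x {A B} → c < n → AgreeOff A B c → (∀ i → A i c ≈ x ⊗ B i c) → det′ n A ≈ x ⊗ det′ n B
  det′-scale n c x c<n A~B column =
    trans (det′-linear n c x 0# c<n A~B A~B (λ i → trans (column i) (sym (plusZeroTimes _ _)))) (plusZeroTimes _ _)
    where
    plusZeroTimes : ∀ a b → a ⊕ 0# ⊗ b ≈ a
    plusZeroTimes a b = trans (+-cong refl (zeroˡ b)) (+-identityʳ a)

  det′-sum : ∀ T n c {A} (B : ℕ → Matrix) (w : ℕ → C) → c < n → (∀ t → AgreeOff A (B t) c) →
             (∀ i → A i c ≈ sumTo T (λ t → w t ⊗ B t i c)) → det′ n A ≈ sumTo T (λ t → w t ⊗ det′ n (B t))
  det′-sum zero    n c B w c<n A~B column =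
    trans (det′-scale n c 0# c<n (λ _ _ _ → refl) (λ i → trans (column i) (sym (zeroˡ _)))) (zeroˡ _)
  det′-sum (suc T) n c {A} B w c<n A~B column =
    trans (det′-linear n c (w 0) 1# c<n (A~B 0) (λ i k k≢c → sym (replaceCol-off A c rest i k k≢c))
             (λ i → trans (column i) (+-cong refl (sym (trans (*-identityˡ _) (replaceCol-at A c rest i))))))
          (+-cong refl (trans (*-identityˡ _)
             (det′-sum T n c (B ∘ suc) (w ∘ suc) c<n (λ t i k k≢c → trans (replaceCol-off A c rest i k k≢c) (A~B (suc t) i k k≢c))
                       (replaceCol-at A c rest))))
    where
    rest : ℕ → C
    rest i = sumTo T (λ t → w (suc t) ⊗ B (suc t) i c)

  -- A matrix with two equal adjacent columns has determinant zero: the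
  -- expansion terms for these two columns cancel, the others vanish by induction.
  det′-adjacentEqual : ∀ n c M → suc c < n → (∀ i → M i c ≈ M i (suc c)) → det′ n M ≈ 0#
  det′-adjacentEqual (suc n) c M c+1<n same = sumTo-pair (suc n) c c+1<n others pair
    where
    s X : C
    s = altSign R c
    X = det′ n (minor M c)

    sameMinor : ∀ i k → minor M (suc c) i k ≈ minor M c i k
    sameMinor i k with k ≟ c
    ... | yes ≡.refl = trans (≡⇒≈ (cong (M (suc i)) (punchInℕ-pred k)))
                             (trans (same (suc i)) (≡⇒≈ (cong (M (suc i)) (≡.sym (punchInℕ-self k)))))
    ... | no  k≢c    = ≡⇒≈ (cong (M (suc i)) (≡.sym (punchInℕ-adjacent c k k≢c)))

    pair : expansionTerm n M c ⊕ expansionTerm n M (suc c) ≈ 0#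
    pair = begin
      s ⊗ (M 0 c ⊗ X) ⊕ ⊖ s ⊗ (M 0 (suc c) ⊗ det′ n (minor M (suc c)))
        ≈⟨ +-cong refl (*-cong refl (*-cong (sym (same 0)) (det′-cong n λ i k _ _ → sameMinor i k))) ⟩
      s ⊗ (M 0 c ⊗ X) ⊕ ⊖ s ⊗ (M 0 c ⊗ X) ≈⟨ sym (distribʳ _ s (⊖ s)) ⟩
      (s ⊕ ⊖ s) ⊗ (M 0 c ⊗ X)             ≈⟨ *-cong (-‿inverseʳ s) refl ⟩
      0# ⊗ (M 0 c ⊗ X)                    ≈⟨ zeroˡ _ ⟩
      0#                                  ∎

    others : ∀ j → j < suc n → j ≢ c → j ≢ suc c → expansionTerm n M j ≈ 0#
    others j j<n j≢c j≢c+1 =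
      trans (*-cong refl (*-cong refl (det′-adjacentEqual n c′ (minor M j) bound sameCols)))
            (trans (*-cong refl (zeroʳ _)) (zeroʳ _))
      where
      c′ : ℕ
      c′ = punchOutℕ j c
      shift : punchOutℕ j (suc c) ≡ suc c′
      shift = punchOutℕ-suc j c (j≢c ∘ ≡.sym) (j≢c+1 ∘ ≡.sym)
      bound : suc c′ < n
      bound = ≡.subst (_< n) shift (punchOutℕ-< j (suc c) j<n c+1<n (j≢c+1 ∘ ≡.sym))
      sameCols : ∀ i → minor M j i c′ ≈ minor M j i (suc c′)
      sameCols i = begin
        minor M j i c′               ≡⟨ minor-column M j c i (j≢c ∘ ≡.sym) ⟩
        M (suc i) c                  ≈⟨ same (suc i) ⟩
        M (suc i) (suc c)            ≡⟨ ≡.sym (minor-column M j (suc c) i (j≢c+1 ∘ ≡.sym)) ⟩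
        minor M j i (punchOutℕ j (suc c)) ≡⟨ cong (minor M j i) shift ⟩
        minor M j i (suc c′)         ∎

  replaceAdjacent : Matrix → ℕ → (ℕ → C) → (ℕ → C) → Matrix
  replaceAdjacent M c u v = replaceCol (replaceCol M c u) (suc c) v

  replaceAdjacent-at₁ : ∀ M c u v i → replaceAdjacent M c u v i c ≈ u i
  replaceAdjacent-at₁ M c u v i = trans (replaceCol-off _ (suc c) v i c (ℕ.1+n≢n ∘ ≡.sym)) (replaceCol-at M c u i)

  replaceAdjacent-at₂ : ∀ M c u v i → replaceAdjacent M c u v i (suc c) ≈ v i
  replaceAdjacent-at₂ M c u v i = replaceCol-at _ (suc c) v i

  replaceAdjacent-off : ∀ M c u v i k → k ≢ c → k ≢ suc c → replaceAdjacent M c u v i k ≈ M i k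
  replaceAdjacent-off M c u v i k k≢c k≢c+1 = trans (replaceCol-off _ (suc c) v i k k≢c+1) (replaceCol-off M c u i k k≢c)

  swapColumns : Matrix → ℕ → Matrix
  swapColumns M c = replaceAdjacent M c (λ i → M i (suc c)) (λ i → M i c)

  -- With β u v the determinant after putting u, v into columns c, c+1,
  -- bilinearity and β u u = 0 give 0 = β (x+y) (x+y) = β x y + β y x.
  det′-swap : ∀ n c M → suc c < n → det′ n (swapColumns M c) ⊕ det′ n M ≈ 0#
  det′-swap n c M c+1<n = begin
    β y x ⊕ det′ n M                            ≈⟨ +-cong refl (sym β-original) ⟩
    β y x ⊕ β x y                               ≈⟨ +-comm _ _ ⟩
    β x y ⊕ β y x                               ≈⟨ +-cong (sym (+-identityˡ _)) (sym (+-identityʳ _)) ⟩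
    (0# ⊕ β x y) ⊕ (β y x ⊕ 0#)                 ≈⟨ +-cong (+-cong (sym (βu,u x)) refl) (+-cong refl (sym (βu,u y))) ⟩
    (β x x ⊕ β x y) ⊕ (β y x ⊕ β y y)           ≈⟨ +-cong (sym (β-additiveʳ x x y)) (sym (β-additiveʳ y x y)) ⟩
    β x (λ i → x i ⊕ y i) ⊕ β y (λ i → x i ⊕ y i) ≈⟨ sym (β-additiveˡ x y _) ⟩
    β (λ i → x i ⊕ y i) (λ i → x i ⊕ y i)       ≈⟨ βu,u _ ⟩
    0#                                          ∎
    where
    x y : ℕ → C
    x i = M i c
    y i = M i (suc c)

    β : (ℕ → C) → (ℕ → C) → C
    β u v = det′ n (replaceAdjacent M c u v)

    βu,u : ∀ u → β u u ≈ 0#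
    βu,u u = det′-adjacentEqual n c _ c+1<n
      (λ i → trans (replaceAdjacent-at₁ M c u u i) (sym (replaceAdjacent-at₂ M c u u i)))

    β-additiveˡ : ∀ u u′ v → β (λ i → u i ⊕ u′ i) v ≈ β u v ⊕ β u′ v
    β-additiveˡ u u′ v = det′-additive n c (ℕ.<-trans (ℕ.n<1+n c) c+1<n)
      (replaceCol-agreeOff (suc c) v (replaceCol-sameOff M c _ u))
      (replaceCol-agreeOff (suc c) v (replaceCol-sameOff M c _ u′))
      (λ i → trans (replaceAdjacent-at₁ M c _ v i) (sym (+-cong (replaceAdjacent-at₁ M c u v i) (replaceAdjacent-at₁ M c u′ v i))))

    β-additiveʳ : ∀ u v v′ → β u (λ i → v i ⊕ v′ i) ≈ β u v ⊕ β u v′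
    β-additiveʳ u v v′ = det′-additive n (suc c) c+1<n
      (replaceCol-sameOff _ (suc c) _ v) (replaceCol-sameOff _ (suc c) _ v′)
      (λ i → trans (replaceAdjacent-at₂ M c u _ i) (sym (+-cong (replaceAdjacent-at₂ M c u v i) (replaceAdjacent-at₂ M c u v′ i))))

    β-original : β x y ≈ det′ n M
    β-original = det′-cong n λ i k _ _ → byCases i k (k ≟ c) (k ≟ suc c)
      where
      byCases : ∀ i k → Dec (k ≡ c) → Dec (k ≡ suc c) → replaceAdjacent M c x y i k ≈ M i k
      byCases i k (yes ≡.refl) _            = replaceAdjacent-at₁ M c x y i
      byCases i k (no _)       (yes ≡.refl) = replaceAdjacent-at₂ M c x y i
      byCases i k (no k≢c)     (no k≢c+1)   = replaceAdjacent-off M c x y i k k≢c k≢c+1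

  -- Equal columns c and c+g+1 force determinant zero: by induction on the
  -- gap g, swapping column c+g+1 with column c+g.
  det′-equalColumnsGap : ∀ n g c M → suc (g + c) < n → (∀ i → M i c ≈ M i (suc (g + c))) → det′ n M ≈ 0#
  det′-equalColumnsGap n zero    c M bound same = det′-adjacentEqual n c M bound same
  det′-equalColumnsGap n (suc g) c M bound same = begin
    det′ n M                                 ≈⟨ sym (+-identityˡ _) ⟩
    0# ⊕ det′ n M                            ≈⟨ +-cong (sym swapped≈0) refl ⟩
    det′ n (swapColumns M e) ⊕ det′ n M      ≈⟨ det′-swap n e M bound ⟩
    0#                                       ∎
    where
    e : ℕ
    e = suc (g + c)
    swapped≈0 : det′ n (swapColumns M e) ≈ 0#
    swapped≈0 = det′-equalColumnsGap n g c (swapColumns M e) (ℕ.<-trans (ℕ.n<1+n e) bound) λ i →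
      trans (replaceAdjacent-off M e _ _ i c (ℕ.m≢1+n+m c) (ℕ.m≢1+n+m c))
            (trans (same i) (sym (replaceAdjacent-at₁ M e _ _ i)))

  det′-equalColumns : ∀ n {c d} M → c < d → d < n → (∀ i → M i c ≈ M i d) → det′ n M ≈ 0#
  det′-equalColumns n {c} {d} M c<d d<n same =
    det′-equalColumnsGap n (d ∸ suc c) c M (≡.subst (_< n) d≡ d<n) (λ i → trans (same i) (≡⇒≈ (cong (M i) d≡)))
    where
    d≡ : d ≡ suc (d ∸ suc c + c)
    d≡ = ≡.trans (≡.sym (ℕ.m∸n+n≡m c<d)) (ℕ.+-suc (d ∸ suc c) c)

  UpperTriangular LowerTriangular : Matrix → Set ℓ
  UpperTriangular Q = ∀ t j → j < t → Q t j ≈ 0#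
  LowerTriangular L = ∀ i k → i < k → L i k ≈ 0#

  -- A lower-triangular matrix with ones on the diagonal has determinant 1:
  -- only the first expansion term survives.
  det′-unitriangular : ∀ n L → LowerTriangular L → (∀ i → L i i ≈ 1#) → det′ n L ≈ 1#
  det′-unitriangular zero    L lower diag = refl
  det′-unitriangular (suc n) L lower diag = begin
    sumTo (suc n) (expansionTerm n L)       ≈⟨ sumTo-single (suc n) 0 (s≤s z≤n) others ⟩
    1# ⊗ (L 0 0 ⊗ det′ n (minor L 0))       ≈⟨ *-identityˡ _ ⟩
    L 0 0 ⊗ det′ n (minor L 0)              ≈⟨ *-cong (diag 0) (det′-unitriangular n (minor L 0)
                                                 (λ i k i<k → lower (suc i) (suc k) (s≤s i<k)) (diag ∘ suc)) ⟩
    1# ⊗ 1#                                 ≈⟨ *-identityˡ 1# ⟩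
    1#                                      ∎
    where
    others : ∀ j → j < suc n → j ≢ 0 → expansionTerm n L j ≈ 0#
    others j _ j≢0 = trans (*-cong refl (trans (*-cong (lower 0 j (ℕ.n≢0⇒n>0 j≢0)) refl) (zeroˡ _))) (zeroʳ _)

  product : ℕ → Matrix → Matrix → Matrix
  product n L Q i j = sumTo n (λ t → L i t ⊗ Q t j)

  -- Column k of
  -- L · Q is ∑_{t ≤ k} Q t k · (column t of L); replacing the columns of
  -- L · Q by those of L from left to right, each replacement pulls out the
  -- factor Q k k, since the terms t < k repeat an earlier column.
  module ProductWithUpperTriangular (n : ℕ) (L Q : Matrix) (Q-upper : UpperTriangular Q) where

    partial : ℕ → Matrix
    partial k i j with j <? k
    ... | yes _ = L i j
    ... | no  _ = product n L Q i j

    partial-< : ∀ k i j → j < k → partial k i j ≈ L i j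
    partial-< k i j j<k with j <? k
    ... | yes _   = refl
    ... | no  j≮k = ⊥-elim (j≮k j<k)

    partial-≥ : ∀ k i j → ¬ j < k → partial k i j ≈ product n L Q i j
    partial-≥ k i j j≮k with j <? k
    ... | yes j<k = ⊥-elim (j≮k j<k)
    ... | no  _   = refl

    partial-step : ∀ k → k < n → det′ n (partial k) ≈ Q k k ⊗ det′ n (partial (suc k))
    partial-step k k<n = begin
      det′ n (partial k)                    ≈⟨ det′-sum n n k B (λ t → Q t k) k<n
                                                 (λ t i j j≢k → sym (replaceCol-off (partial k) k _ i j j≢k)) column ⟩
      sumTo n (λ t → Q t k ⊗ det′ n (B t))  ≈⟨ sumTo-single n k k<n others ⟩
      Q k k ⊗ det′ n (B k)                  ≈⟨ *-cong refl (det′-cong n λ i j _ _ → Bk≈next i j (j ≟ k) (j <? k)) ⟩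
      Q k k ⊗ det′ n (partial (suc k))      ∎
      where
      B : ℕ → Matrix
      B t = replaceCol (partial k) k (λ i → L i t)

      column : ∀ i → partial k i k ≈ sumTo n (λ t → Q t k ⊗ B t i k)
      column i = trans (partial-≥ k i k (ℕ.<-irrefl ≡.refl))
        (sumTo-cong n λ t _ → trans (*-comm _ _) (*-cong refl (sym (replaceCol-at (partial k) k _ i))))

      others : ∀ t → t < n → t ≢ k → Q t k ⊗ det′ n (B t) ≈ 0#
      others t t<n t≢k with t <? k
      ... | yes t<k = trans (*-cong refl (det′-equalColumns n (B t) t<k k<n λ i →
                        trans (replaceCol-off (partial k) k _ i t t≢k)
                              (trans (partial-< k i t t<k) (sym (replaceCol-at (partial k) k _ i)))))
                            (zeroʳ _)
      ... | no  t≮k = trans (*-cong (Q-upper t k (ℕ.≤∧≢⇒< (ℕ.≮⇒≥ t≮k) (t≢k ∘ ≡.sym))) refl) (zeroˡ _)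

      Bk≈next : ∀ i j → Dec (j ≡ k) → Dec (j < k) → B k i j ≈ partial (suc k) i j
      Bk≈next i j (yes ≡.refl) _       = trans (replaceCol-at (partial j) j _ i) (sym (partial-< (suc j) i j (ℕ.n<1+n j)))
      Bk≈next i j (no j≢k)     (yes j<k) = trans (replaceCol-off (partial k) k _ i j j≢k)
        (trans (partial-< k i j j<k) (sym (partial-< (suc k) i j (ℕ.m<n⇒m<1+n j<k))))
      Bk≈next i j (no j≢k)     (no j≮k)  = trans (replaceCol-off (partial k) k _ i j j≢k)
        (trans (partial-≥ k i j j≮k)
               (sym (partial-≥ (suc k) i j λ j<k+1 → j≢k (ℕ.≤-antisym (ℕ.≤-pred j<k+1) (ℕ.≮⇒≥ j≮k)))))

    partial-steps : ∀ g k → k + g ≡ n → det′ n (partial k) ≈ prodFrom R k g (λ t → Q t t) ⊗ det′ n L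
    partial-steps zero    k k+0≡n =
      trans (det′-cong n λ i j _ j<n → partial-< k i j (≡.subst (j <_) n≡k j<n)) (sym (*-identityˡ _))
      where
      n≡k : n ≡ k
      n≡k = ≡.trans (≡.sym k+0≡n) (ℕ.+-identityʳ k)
    partial-steps (suc g) k k+g+1≡n = begin
      det′ n (partial k)                                        ≈⟨ partial-step k (≡.subst (k <_) k+g+1≡n (ℕ.m<m+n k (s≤s z≤n))) ⟩
      Q k k ⊗ det′ n (partial (suc k))                          ≈⟨ *-cong refl (partial-steps g (suc k)
                                                                      (≡.trans (≡.sym (ℕ.+-suc k g)) k+g+1≡n)) ⟩
      Q k k ⊗ (prodFrom R (suc k) g (λ t → Q t t) ⊗ det′ n L)   ≈⟨ sym (*-assoc _ _ _) ⟩
      prodFrom R k (suc g) (λ t → Q t t) ⊗ det′ n L             ∎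

    det′-product : det′ n (product n L Q) ≈ prodFrom R 0 n (λ t → Q t t) ⊗ det′ n L
    det′-product = trans (det′-cong n λ i j _ _ → sym (partial-≥ 0 i j λ ())) (partial-steps n 0 ≡.refl)

  det′-factorised : ∀ n M L Q → (∀ i j → i < n → j < n → M i j ≈ product n L Q i j) →
                    LowerTriangular L → (∀ i → L i i ≈ 1#) → UpperTriangular Q →
                    det′ n M ≈ prodFrom R 0 n (λ t → Q t t)
  det′-factorised n M L Q M≈LQ L-lower L-diag Q-upper = begin
    det′ n M                                   ≈⟨ det′-cong n M≈LQ ⟩
    det′ n (product n L Q)                     ≈⟨ ProductWithUpperTriangular.det′-product n L Q Q-upper ⟩
    prodFrom R 0 n (λ t → Q t t) ⊗ det′ n L    ≈⟨ *-cong refl (det′-unitriangular n L L-lower L-diag) ⟩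
    prodFrom R 0 n (λ t → Q t t) ⊗ 1#          ≈⟨ *-identityʳ _ ⟩
    prodFrom R 0 n (λ t → Q t t)               ∎

module StepSequenceSums {c ℓ : Level} (R : CommutativeRing c ℓ) where
  open CommutativeRing R renaming (Carrier to C; _+_ to _⊕_; _*_ to _⊗_)
  open import Relation.Binary.Reasoning.Setoid setoid
  open FiniteSums R

  sumSeqs : ℕ → (List Step → C) → C
  sumSeqs L = sumOver (allSeqs L)

  sumSeqs-suc : ∀ L f → sumSeqs (suc L) f ≈ sumSeqs L (f ∘ (rise ∷_)) ⊕ sumSeqs L (f ∘ (fall ∷_))
  sumSeqs-suc L f = begin
    sumList R (map f (map (rise ∷_) A ++ map (fall ∷_) A))
      ≈⟨ sumOver-++ (map (rise ∷_) A) (map (fall ∷_) A) f ⟩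
    sumList R (map f (map (rise ∷_) A)) ⊕ sumList R (map f (map (fall ∷_) A))
      ≡⟨ ≡.cong₂ (λ xs ys → sumList R xs ⊕ sumList R ys) (≡.sym (List.map-∘ A)) (≡.sym (List.map-∘ A)) ⟩
    sumSeqs L (f ∘ (rise ∷_)) ⊕ sumSeqs L (f ∘ (fall ∷_)) ∎
    where
    A : List (List Step)
    A = allSeqs L

  sumSeqs-cong : ∀ L {f g} → (∀ s → length s ≡ L → f s ≈ g s) → sumSeqs L f ≈ sumSeqs L g
  sumSeqs-cong zero    f≈g = +-cong (f≈g [] ≡.refl) refl
  sumSeqs-cong (suc L) {f} {g} f≈g = begin
    sumSeqs (suc L) f                                        ≈⟨ sumSeqs-suc L f ⟩
    sumSeqs L (f ∘ (rise ∷_)) ⊕ sumSeqs L (f ∘ (fall ∷_))    ≈⟨ +-cong (sumSeqs-cong L λ s → f≈g (rise ∷ s) ∘ cong suc)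
                                                                        (sumSeqs-cong L λ s → f≈g (fall ∷ s) ∘ cong suc) ⟩
    sumSeqs L (g ∘ (rise ∷_)) ⊕ sumSeqs L (g ∘ (fall ∷_))    ≈⟨ sym (sumSeqs-suc L g) ⟩
    sumSeqs (suc L) g                                        ∎

  sumSeqs-zero : ∀ L {f} → (∀ s → length s ≡ L → f s ≈ 0#) → sumSeqs L f ≈ 0#
  sumSeqs-zero zero    f≈0 = trans (+-identityʳ _) (f≈0 [] ≡.refl)
  sumSeqs-zero (suc L) {f} f≈0 = trans (sumSeqs-suc L f)
    (trans (+-cong (sumSeqs-zero L λ s → f≈0 (rise ∷ s) ∘ cong suc) (sumSeqs-zero L λ s → f≈0 (fall ∷ s) ∘ cong suc))
           (+-identityˡ 0#))

  sumSeqs-single : ∀ L {f} u → length u ≡ L → (∀ s → length s ≡ L → s ≢ u → f s ≈ 0#) → sumSeqs L f ≈ f u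
  sumSeqs-single zero    []         _   others = +-identityʳ _
  sumSeqs-single (suc L) {f} (rise ∷ u) len others = trans (sumSeqs-suc L f)
    (trans (+-cong (sumSeqs-single L u (ℕ.suc-injective len) λ s len′ s≢u →
                      others (rise ∷ s) (cong suc len′) (s≢u ∘ List.∷-injectiveʳ))
                   (sumSeqs-zero L λ s len′ → others (fall ∷ s) (cong suc len′) λ ()))
           (+-identityʳ _))
  sumSeqs-single (suc L) {f} (fall ∷ u) len others = trans (sumSeqs-suc L f)
    (trans (+-cong (sumSeqs-zero L λ s len′ → others (rise ∷ s) (cong suc len′) λ ())
                   (sumSeqs-single L u (ℕ.suc-injective len) λ s len′ s≢u →
                      others (fall ∷ s) (cong suc len′) (s≢u ∘ List.∷-injectiveʳ)))
           (+-identityˡ _))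

  sumSeqs-split : ∀ a b f → sumSeqs (a + b) f ≈ sumSeqs a (λ s₁ → sumSeqs b (λ s₂ → f (s₁ ++ s₂)))
  sumSeqs-split zero    b f = sym (+-identityʳ _)
  sumSeqs-split (suc a) b f = trans (sumSeqs-suc (a + b) f)
    (trans (+-cong (sumSeqs-split a b _) (sumSeqs-split a b _)) (sym (sumSeqs-suc a _)))

module Paths {c ℓ : Level} (R : CommutativeRing c ℓ) (D : ℕ) (V : ℕ → CommutativeRing.Carrier R) where
  open CommutativeRing R renaming (Carrier to C; _+_ to _⊕_; _*_ to _⊗_)
  open import Relation.Binary.Reasoning.Setoid setoid
  open FiniteSums R
  open StepSequenceSums R
  open Heights D

  weight : ℕ → List Step → C
  weight = pathWeight R (suc D) V

  weight-++ : ∀ h s₁ s₂ {x} → end h s₁ ≡ just x → weight h (s₁ ++ s₂) ≈ weight h s₁ ⊗ weight x s₂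
  weight-++ h       []          s₂ ≡.refl = sym (*-identityˡ _)
  weight-++ h       (rise ∷ s₁) s₂ e      = weight-++ (h + D) s₁ s₂ e
  weight-++ (suc h) (fall ∷ s₁) s₂ e      = trans (*-cong refl (weight-++ h s₁ s₂ e)) (sym (*-assoc _ _ _))

  weight-rises : ∀ h L → weight h (replicate L rise) ≈ 1#
  weight-rises h zero    = refl
  weight-rises h (suc L) = weight-rises (h + D) L

  weight-falls : ∀ h → weight h (replicate h fall) ≈ prod1to R h V
  weight-falls zero    = refl
  weight-falls (suc h) = trans (*-cong refl (weight-falls h)) (trans (*-comm _ _) (sym (prodFrom-snoc 1 h V)))

  endsAt : Maybe ℕ → ℕ → C
  endsAt nothing  h₀ = 0#
  endsAt (just x) h₀ with x ≟ h₀
  ... | yes _ = 1#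
  ... | no  _ = 0#

  endsAt-hit : ∀ x → endsAt (just x) x ≈ 1#
  endsAt-hit x with x ≟ x
  ... | yes _   = refl
  ... | no  x≢x = ⊥-elim (x≢x ≡.refl)

  endsAt-miss : ∀ e h₀ → e ≢ just h₀ → endsAt e h₀ ≈ 0#
  endsAt-miss nothing  h₀ _ = refl
  endsAt-miss (just x) h₀ e≢ with x ≟ h₀
  ... | yes ≡.refl = ⊥-elim (e≢ ≡.refl)
  ... | no  _      = refl

  pathTo : ℕ → ℕ → List Step → C
  pathTo h₀ h s = endsAt (end h s) h₀ ⊗ weight h s

  pathTo-hit : ∀ h₀ h s → end h s ≡ just h₀ → pathTo h₀ h s ≈ weight h s
  pathTo-hit h₀ h s e = trans (*-cong (trans (≡⇒≈ (cong (λ x → endsAt x h₀) e)) (endsAt-hit h₀)) refl) (*-identityˡ _)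

  pathTo-miss : ∀ h₀ h s → end h s ≢ just h₀ → pathTo h₀ h s ≈ 0#
  pathTo-miss h₀ h s e≢ = trans (*-cong (endsAt-miss (end h s) h₀ e≢) refl) (zeroˡ _)

  pathTo-nothing : ∀ h₀ h s → end h s ≡ nothing → pathTo h₀ h s ≈ 0#
  pathTo-nothing h₀ h s e = trans (*-cong (≡⇒≈ (cong (λ y → endsAt y h₀) e)) refl) (zeroˡ _)

  contrib≈pathTo : ∀ h s → contrib R (suc D) V h s ≈ pathTo 0 h s
  contrib≈pathTo h s with end h s
  ... | nothing      = sym (zeroˡ _)
  ... | just zero    = sym (*-identityˡ _)
  ... | just (suc x) = sym (zeroˡ _)

  pathTo-++ : ∀ h₀ h s₁ s₂ {x} → end h s₁ ≡ just x → pathTo h₀ h (s₁ ++ s₂) ≈ weight h s₁ ⊗ pathTo h₀ x s₂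
  pathTo-++ h₀ h s₁ s₂ {x} e = begin
    endsAt (end h (s₁ ++ s₂)) h₀ ⊗ weight h (s₁ ++ s₂)  ≡⟨ cong (λ y → endsAt y h₀ ⊗ _)
                                                             (≡.trans (end-++ h s₁ s₂) (cong (_>>= _) e)) ⟩
    endsAt (end x s₂) h₀ ⊗ weight h (s₁ ++ s₂)          ≈⟨ *-cong refl (weight-++ h s₁ s₂ e) ⟩
    endsAt (end x s₂) h₀ ⊗ (weight h s₁ ⊗ weight x s₂)  ≈⟨ x∙yz≈y∙xz _ _ _ ⟩
    weight h s₁ ⊗ (endsAt (end x s₂) h₀ ⊗ weight x s₂)  ∎
    where open import Algebra.Properties.CommutativeSemigroup *-commutativeSemigroup using (x∙yz≈y∙xz)

  pathTo-cut : ∀ N (ℓ : ℕ → ℕ) → (∀ {t t′} → ℓ t ≡ ℓ t′ → t ≡ t′) → ∀ h₀ h s₁ s₂ →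
               (∀ {x} → end h s₁ ≡ just x → Σ[ t ∈ ℕ ] t < N × x ≡ ℓ t) →
               pathTo h₀ h (s₁ ++ s₂) ≈ sumTo N (λ t → pathTo (ℓ t) h s₁ ⊗ pathTo h₀ (ℓ t) s₂)
  pathTo-cut N ℓ ℓ-injective h₀ h s₁ s₂ covered = byEnd (end h s₁) ≡.refl
    where
    cut : ℕ → C
    cut t = pathTo (ℓ t) h s₁ ⊗ pathTo h₀ (ℓ t) s₂

    byEnd : ∀ y → end h s₁ ≡ y → pathTo h₀ h (s₁ ++ s₂) ≈ sumTo N cut
    byEnd nothing e = begin
      pathTo h₀ h (s₁ ++ s₂)  ≈⟨ pathTo-nothing h₀ h (s₁ ++ s₂) (≡.trans (end-++ h s₁ s₂) (cong (_>>= _) e)) ⟩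
      0#                      ≈⟨ sym (sumTo-zero N λ t _ → trans (*-cong (pathTo-nothing (ℓ t) h s₁ e) refl) (zeroˡ _)) ⟩
      sumTo N cut             ∎
    byEnd (just x) e with covered e
    ... | t₀ , t₀<N , ≡.refl = begin
      pathTo h₀ h (s₁ ++ s₂)                    ≈⟨ pathTo-++ h₀ h s₁ s₂ e ⟩
      weight h s₁ ⊗ pathTo h₀ (ℓ t₀) s₂         ≈⟨ *-cong (sym (pathTo-hit (ℓ t₀) h s₁ e)) refl ⟩
      cut t₀                                    ≈⟨ sym (sumTo-single N t₀ t₀<N others) ⟩
      sumTo N cut                               ∎
      where
      others : ∀ t → t < N → t ≢ t₀ → cut t ≈ 0#
      others t _ t≢t₀ = trans (*-cong (pathTo-miss (ℓ t) h s₁ λ e′ →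
                          t≢t₀ (ℓ-injective (≡.sym (Maybe.just-injective (≡.trans (≡.sym e) e′))))) refl) (zeroˡ _)

  sumSeqs-cut : ∀ a b N (ℓ : ℕ → ℕ) → (∀ {t t′} → ℓ t ≡ ℓ t′ → t ≡ t′) → ∀ h₀ h →
                (∀ s₁ {x} → length s₁ ≡ a → end h s₁ ≡ just x → Σ[ t ∈ ℕ ] t < N × x ≡ ℓ t) →
                sumSeqs (a + b) (pathTo h₀ h) ≈ sumTo N (λ t → sumSeqs a (pathTo (ℓ t) h) ⊗ sumSeqs b (pathTo h₀ (ℓ t)))
  sumSeqs-cut a b N ℓ ℓ-injective h₀ h covered = begin
    sumSeqs (a + b) (pathTo h₀ h)
      ≈⟨ sumSeqs-split a b _ ⟩
    sumSeqs a (λ s₁ → sumSeqs b (λ s₂ → pathTo h₀ h (s₁ ++ s₂)))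
      ≈⟨ sumSeqs-cong a cutAfter ⟩
    sumSeqs a (λ s₁ → sumTo N (λ t → pathTo (ℓ t) h s₁ ⊗ sumSeqs b (pathTo h₀ (ℓ t))))
      ≈⟨ sumOver-sumTo (allSeqs a) N _ ⟩
    sumTo N (λ t → sumSeqs a (λ s₁ → pathTo (ℓ t) h s₁ ⊗ sumSeqs b (pathTo h₀ (ℓ t))))
      ≈⟨ sumTo-cong N (λ t _ → sumOver-scaleʳ (allSeqs a) _ _) ⟩
    sumTo N (λ t → sumSeqs a (pathTo (ℓ t) h) ⊗ sumSeqs b (pathTo h₀ (ℓ t))) ∎
    where
    cutAfter : ∀ s₁ → length s₁ ≡ a → sumSeqs b (λ s₂ → pathTo h₀ h (s₁ ++ s₂)) ≈
                                      sumTo N (λ t → pathTo (ℓ t) h s₁ ⊗ sumSeqs b (pathTo h₀ (ℓ t)))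
    cutAfter s₁ len = begin
      sumSeqs b (λ s₂ → pathTo h₀ h (s₁ ++ s₂))
        ≈⟨ sumSeqs-cong b (λ s₂ _ → pathTo-cut N ℓ ℓ-injective h₀ h s₁ s₂ (covered s₁ len)) ⟩
      sumSeqs b (λ s₂ → sumTo N (λ t → pathTo (ℓ t) h s₁ ⊗ pathTo h₀ (ℓ t) s₂))
        ≈⟨ sumOver-sumTo (allSeqs b) N _ ⟩
      sumTo N (λ t → sumSeqs b (λ s₂ → pathTo (ℓ t) h s₁ ⊗ pathTo h₀ (ℓ t) s₂))
        ≈⟨ sumTo-cong N (λ t _ → sumOver-scaleˡ (allSeqs b) _ _) ⟩
      sumTo N (λ t → pathTo (ℓ t) h s₁ ⊗ sumSeqs b (pathTo h₀ (ℓ t))) ∎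

  F≈sumSeqs : ∀ r n → F R (suc D) V r n ≈ sumSeqs (r + n * suc D) (pathTo 0 r)
  F≈sumSeqs r n = sumSeqs-cong (r + n * suc D) λ s _ → contrib≈pathTo r s

module Factorisation {c ℓ : Level} (R : CommutativeRing c ℓ) (d : ℕ) (V : ℕ → CommutativeRing.Carrier R)
                     (m : ℕ) (m<p : m < suc (suc d)) where
  open CommutativeRing R using (_≈_; 0#; 1#; setoid)
  open import Relation.Binary.Reasoning.Setoid setoid
  open Determinants R using (Matrix; LowerTriangular; UpperTriangular; product)
  open StepSequenceSums R
  open Levels d m m<p
  open Heights D
  open Paths R D V

  lower upper : Matrix
  lower i t = sumSeqs (i + q i) (pathTo (level t) (r i))
  upper t j = sumSeqs (level j) (pathTo 0 (level t))

  -- A first part from r_i reaches only levels t ≤ i.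
  lower-triangular : LowerTriangular lower
  lower-triangular i t i<t = sumSeqs-zero (i + q i) λ s len → pathTo-miss (level t) (r i) s λ e →
    let (t′ , t′≤i , _ , level-t≡) = end-level i s len e
    in ℕ.<⇒≱ i<t (≡.subst (_≤ i) (≡.sym (level-injective level-t≡)) t′≤i)

  -- Only the all-rises path reaches level i.
  lower-diagonal : ∀ i → lower i i ≈ 1#
  lower-diagonal i = begin
    sumSeqs (i + q i) (pathTo (level i) (r i))  ≈⟨ sumSeqs-single (i + q i) u (List.length-replicate (i + q i)) others ⟩
    pathTo (level i) (r i) u                    ≈⟨ pathTo-hit (level i) (r i) u
                                                     (≡.trans (end-rises (r i) (i + q i)) (cong just (rises-end i))) ⟩
    weight (r i) u                              ≈⟨ weight-rises (r i) (i + q i) ⟩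
    1#                                          ∎
    where
    u : List Step
    u = replicate (i + q i) rise
    others : ∀ s → length s ≡ i + q i → s ≢ u → pathTo (level i) (r i) s ≈ 0#
    others s len s≢u = pathTo-miss (level i) (r i) s λ e →
      let (t′ , _ , rises≡ , level-i≡) = end-level i s len e
          allRises : rises s ≡ length s
          allRises = ≡.trans rises≡ (≡.trans (cong (q i +_) (≡.sym (level-injective level-i≡)))
                                             (≡.trans (ℕ.+-comm (q i) i) (≡.sym len)))
      in s≢u (≡.trans (rises≡length s allRises) (cong (λ L → replicate L rise) len))

  -- A path from level t down to 0 with j p + m steps has j - t ≥ 0 rises.
  upper-triangular : UpperTriangular upper
  upper-triangular t j j<t = sumSeqs-zero (level j) λ s len → pathTo-miss 0 (level t) s λ e →
    ℕ.<⇒≱ j<t (≡.subst (t ≤_) (≡.sym (descent t j s len e)) (ℕ.m≤m+n t (rises s)))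

  -- Only the all-falls path descends from level t to 0 in t p + m steps.
  upper-diagonal : ∀ t → upper t t ≈ prod1to R (level t) V
  upper-diagonal t = begin
    sumSeqs (level t) (pathTo 0 (level t))  ≈⟨ sumSeqs-single (level t) u (List.length-replicate (level t)) others ⟩
    pathTo 0 (level t) u                    ≈⟨ pathTo-hit 0 (level t) u (end-falls (level t)) ⟩
    weight (level t) u                      ≈⟨ weight-falls (level t) ⟩
    prod1to R (level t) V                   ∎
    where
    u : List Step
    u = replicate (level t) fall
    others : ∀ s → length s ≡ level t → s ≢ u → pathTo 0 (level t) s ≈ 0#
    others s len s≢u = pathTo-miss 0 (level t) s λ e →
      let noRises : rises s ≡ 0
          noRises = ℕ.+-cancelˡ-≡ t (rises s) 0 (≡.trans (≡.sym (descent t t s len e)) (≡.sym (ℕ.+-identityʳ t)))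
      in s≢u (≡.trans (rises≡0 s noRises) (cong (λ L → replicate L fall) len))

  -- F^{(r_i)}_{q_i + j} = ∑_t lower i t · upper t j, cutting the paths after i + q_i steps.
  entries-factor : ∀ n i j → i < n → F R p V (r i) (q i + j) ≈ product n lower upper i j
  entries-factor n i j i<n = begin
    F R p V (r i) (q i + j)                        ≈⟨ F≈sumSeqs (r i) (q i + j) ⟩
    sumSeqs (r i + (q i + j) * p) (pathTo 0 (r i)) ≡⟨ cong (λ L → sumSeqs L (pathTo 0 (r i))) (F-length i j) ⟩
    sumSeqs ((i + q i) + level j) (pathTo 0 (r i)) ≈⟨ sumSeqs-cut (i + q i) (level j) n level level-injective 0 (r i) covered ⟩
    product n lower upper i j                      ∎
    where
    covered : ∀ s₁ {x} → length s₁ ≡ i + q i → end (r i) s₁ ≡ just x → Σ[ t ∈ ℕ ] t < n × x ≡ level t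
    covered s₁ len e with end-level i s₁ len e
    ... | t , t≤i , _ , x≡ = t , ℕ.≤-<-trans t≤i i<n , x≡

theorem3 : {c ℓ : Level} (R : CommutativeRing c ℓ) (V : ℕ → CommutativeRing.Carrier R)
    (p : ℕ) → 2 ≤ p → (m : ℕ) → m < p → (n : ℕ) →
    CommutativeRing._≈_ R
      (det R (suc n) (λ i j →
        F R p V (rr p (toℕ i + m)) (qq p (toℕ i + m) + toℕ j)))
      (prod0to R n (λ i → prod1to R (i * p + m) V))
theorem3 R V zero          ()        m m<p n
theorem3 R V (suc zero)    (s≤s ())  m m<p n
theorem3 R V (suc (suc d)) _         m m<p n = begin
  det R (suc n) (λ i j → F R p V (r (toℕ i)) (q (toℕ i) + toℕ j))
    ≈⟨ det≈det′ (suc n) _ (λ i j → F R p V (r i) (q i + j)) (λ _ _ → refl) ⟩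
  det′ (suc n) (λ i j → F R p V (r i) (q i + j))
    ≈⟨ det′-factorised (suc n) _ lower upper (λ i j i<n _ → entries-factor (suc n) i j i<n)
                       lower-triangular lower-diagonal upper-triangular ⟩
  prodFrom R 0 (suc n) (λ t → upper t t)
    ≈⟨ prodFrom-cong 0 (suc n) upper-diagonal ⟩
  prod0to R n (λ i → prod1to R (i * p + m) V) ∎
  where
  open CommutativeRing R using (refl; setoid)
  open import Relation.Binary.Reasoning.Setoid setoid
  open Determinants R using (det≈det′; det′; det′-factorised)
  open FiniteSums R using (prodFrom-cong)
  open Levels d m m<p using (p; q; r)
  open Factorisation R d V m m<p
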